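{- Let $n>1$ be an integer with prime factorization $n=p_1^{m_1}\cdots p_\omega^{m_\omega}$ ($p_1<\dots<p_\omega$ distinct primes, $m_i\ge 1$), and let $M'(n)=[m_1,\dots,m_\omega]$ be its prime signature (a multiset). For a nonempty finite multiset $M$ of positive integers put $V(M)=\prod_{m\in M}(m+1)$, and define $E(M)$ recursively by: $E(M)=m_1$ if $M=[m_1]$ has one element; and, if $|M|>1$, $E(M)=E(M-[m_i])\cdot(m_i+1)+m_i\cdot V(M-[m_i])$, where $m_i$ is an element of $M$ and $M-[m_i]$ denotes $M$ with one copy of $m_i$ removed. Then, whichever element is removed at each step, $E(M'(n))=|E^H(n)|$, the number of arcs of the Hasse diagram $G^H(n)$.
   Context: For a positive integer $n$, $V(n)$ is the set of positive divisors of $n$. The transitive closure graph $G^T(n)$ is the directed graph on $V(n)$ with arc set $E^T(n)=\{(a,b): a,b\in V(n),\ a<b,\ a\mid b\}$. The Hasse diagram $G^H(n)$ is the directed graph on $V(n)$ with arc set $E^H(n)$ consisting of those $(a,b)\in E^T(n)$ for which there is no $c\in V(n)$ with $a<c<b$, $a\mid c$ and $c\mid b$. -}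

module Defs where

open import Data.Nat using (ℕ; zero; suc; _+_; _*_; _^_; _<_; _≤_; _<?_)
open import Data.Nat.Divisibility using (_∣_; _∣?_)
open import Data.Nat.Primality using (Prime)
open import Data.Nat.ListAction using (product)
open import Data.Product using (_×_; _,_; proj₁; proj₂)
open import Data.List using (List; []; _∷_; [_]; map; filter; length; upTo; cartesianProduct)
open import Data.List.Relation.Unary.All using (All)
open import Data.List.Relation.Unary.Any using (Any; any?)
open import Data.List.Relation.Unary.Linked using (Linked)
open import Data.List.Relation.Binary.Permutation.Propositional using (_↭_)
open import Relation.Nullary using (¬_; Dec; ¬?)
open import Relation.Nullary.Decidable using (_×-dec_)

V : ℕ → List ℕ
V n = filter (λ d → d ∣? n) (map suc (upTo n))

Between : ℕ → ℕ → ℕ → Set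
Between a b c = (a < c) × (c < b) × (a ∣ c) × (c ∣ b)

between? : ∀ a b c → Dec (Between a b c)
between? a b c = (a <? c) ×-dec ((c <? b) ×-dec ((a ∣? c) ×-dec (c ∣? b)))

IsHasseArc : ℕ → ℕ × ℕ → Set
IsHasseArc n (a , b) = (a < b) × (a ∣ b) × ¬ Any (Between a b) (V n)

isHasseArc? : ∀ n p → Dec (IsHasseArc n p)
isHasseArc? n (a , b) = (a <? b) ×-dec ((a ∣? b) ×-dec ¬? (any? (between? a b) (V n)))

hasseArcs : ℕ → List (ℕ × ℕ)
hasseArcs n = filter (isHasseArc? n) (cartesianProduct (V n) (V n))

numHasseArcs : ℕ → ℕ
numHasseArcs n = length (hasseArcs n)

IsPrimeFactorization : ℕ → List (ℕ × ℕ) → Set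
IsPrimeFactorization n fs =
  All (λ pm → Prime (proj₁ pm)) fs ×
  Linked _<_ (map proj₁ fs) ×
  All (λ pm → 1 ≤ proj₂ pm) fs ×
  product (map (λ pm → proj₁ pm ^ proj₂ pm) fs) ≡ n
  where open import Relation.Binary.PropositionalEquality using (_≡_)

-- prime signature M'(n) = [m₁,…,m_ω] (multisets represented as lists up to permutation)
signature : List (ℕ × ℕ) → List ℕ
signature fs = map proj₂ fs

VM : List ℕ → ℕ
VM M = product (map suc M)

-- IsE M e : e is a value of E(M) obtained by some sequence of choices of the
-- removed element. M - [m] is any M' with M ↭ m ∷ M'.
data IsE : List ℕ → ℕ → Set where
  single : ∀ m → IsE [ m ] m
  step   : ∀ {M} m M' e' → M ↭ m ∷ M' → IsE M' e' →
           IsE M (e' * suc m + m * VM M')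

module Submission where

-- The arcs of G^H(n) are exactly the covers of the divisibility order: pairs
-- (a , b) of divisors of n with b = a·q for a prime q (a composite cofactor
-- would give a divisor strictly between a and b, a prime one cannot).
-- Writing n = p^m · r with p prime and p ∤ r, the divisors of n are the p^i·d
-- (i ≤ m, d ∣ r), and the covers of n are
--   * the covers of r scaled by p^i (i ≤ m): (m+1)·E(r) arcs, and
--   * the arcs (p^i·d , p^(i+1)·d) for d ∣ r and i < m: m·V(r) arcs.  Counting the lists shows that
-- |E^H(n)| is the value hasseCount of E obtained by always removing the first
-- exponent; since hasseCount is invariant under permutation, every value of
-- E(M'(n)) allowed by IsE equals it.

open import Defs
open import Data.Nat using (ℕ; zero; suc; _+_; _*_; _^_; _<_; z<s; NonZero; NonTrivial; _≟_)
open import Data.Nat using (>-nonZero; ≢-nonZero; n>1⇒nonTrivial; nonTrivial⇒n>1; nonTrivial⇒≢1; nonTrivial⇒nonZero)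
open import Data.Nat.Properties
open import Data.Nat.Divisibility
open import Data.Nat.Primality using (Prime; prime; Composite; composite; euclidsLemma; prime⇒irreducible; prime⇒nonTrivial)
open import Data.Nat.Coprimality using (Coprime; coprime-divisor)
open import Data.Nat.ListAction using (product)
open import Data.Nat.ListAction.Properties using (product-↭)
open import Data.Nat.Solver using (module +-*-Solver)
open +-*-Solver using (solve; _:=_; _:+_; _:*_; con)
open import Data.Product using (_×_; _,_; ∃; proj₁; proj₂)
open import Data.Sum using (_⊎_; inj₁; inj₂)
open import Data.Empty using (⊥; ⊥-elim)
open import Data.Unit using (⊤; tt)
open import Data.List using (List; []; _∷_; [_]; map; length; upTo; cartesianProduct; _++_)
open import Data.List.Properties using (length-++; length-map)
open import Data.List.Membership.Propositional using (_∈_; lose)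
open import Data.List.Membership.Propositional.Properties
open import Data.List.Membership.Propositional.Properties.WithK using (unique∧set⇒bag)
open import Data.List.Relation.Unary.Any using (here; satisfied)
open import Data.List.Relation.Unary.All using (All; []; _∷_)
import Data.List.Relation.Unary.All as All
open import Data.List.Relation.Unary.AllPairs using ([]; _∷_)
open import Data.List.Relation.Unary.Unique.Propositional using (Unique)
import Data.List.Relation.Unary.Unique.Propositional.Properties as Unique
open import Data.List.Relation.Unary.Linked using (Linked; []; [-]; _∷_)
open import Data.List.Relation.Binary.BagAndSetEquality using (∼bag⇒↭)
open import Data.List.Relation.Binary.Permutation.Propositional using (_↭_; ↭-refl)
open import Data.List.Relation.Binary.Permutation.Propositional.Properties using (↭-length; map⁺)
open import Function.Bundles using (_⇔_; mk⇔; Equivalence)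
import Function.Properties.Equivalence as ⇔
open import Relation.Nullary using (¬_; yes; no)
open import Relation.Binary.PropositionalEquality using (_≡_; refl; sym; trans; cong; cong₂; subst; subst₂; module ≡-Reasoning)

open Equivalence using (to; from)

unique-length : ∀ {A : Set} {xs ys : List A} → Unique xs → Unique ys →
                (∀ {x} → x ∈ xs ⇔ x ∈ ys) → length xs ≡ length ys
unique-length uxs uys same = ↭-length (∼bag⇒↭ (unique∧set⇒bag uxs uys same))

Cover : ℕ → ℕ × ℕ → Set
Cover n (a , b) = a ∣ n × b ∣ n × ∃ λ q → Prime q × b ≡ a * q

divisor-nonZero : ∀ {a n} → 0 < n → a ∣ n → NonZero a
divisor-nonZero 0<n a∣n = ≢-nonZero λ { refl → <-irrefl (sym (0∣⇒≡0 a∣n)) 0<n }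

divisor∈V : ∀ {d n} → 0 < n → d ∣ n → d ∈ V n
divisor∈V {zero} 0<n d∣n = ⊥-elim (<-irrefl (sym (0∣⇒≡0 d∣n)) 0<n)
divisor∈V {suc d} {n} 0<n d∣n =
  ∈-filter⁺ (_∣? n) (∈-map⁺ suc (∈-upTo⁺ (∣⇒≤ {{>-nonZero 0<n}} d∣n))) d∣n

∈V⇒divisor : ∀ {d n} → d ∈ V n → d ∣ n
∈V⇒divisor {n = n} d∈ = proj₂ (∈-filter⁻ (_∣? n) {xs = map suc (upTo n)} d∈)

V-unique : ∀ n → Unique (V n)
V-unique n = Unique.filter⁺ (_∣? n) (Unique.map⁺ suc-injective (Unique.upTo⁺ n))

hasseArcs-unique : ∀ n → Unique (hasseArcs n)
hasseArcs-unique n = Unique.filter⁺ (isHasseArc? n) (Unique.cartesianProduct⁺ (V-unique n) (V-unique n))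

factor-between : ∀ {a b k d} → .{{NonZero a}} → b ≡ a * k →
                 1 < d → d < k → d ∣ k → Between a b (a * d)
factor-between {a} b≡ 1<d d<k d∣k =
  m<m*n a _ 1<d , subst (a * _ <_) (sym b≡) (*-monoʳ-< a d<k) ,
  m∣m*n _ , subst (a * _ ∣_) (sym b≡) (*-monoʳ-∣ a d∣k)

-- With a prime cofactor there is no intermediate divisor: c = k·a and
-- b = l·c force k·l = q, so c = a or c = b.
prime-factor-no-between : ∀ {a b q c} → .{{NonZero a}} → Prime q → b ≡ a * q →
                          ¬ Between a b c
prime-factor-no-between {a} {b} {q} q-prime b≡ (a<c , c<b , divides k c≡ , divides l b≡l) =
  excluded (prime⇒irreducible q-prime (divides l q≡l*k))
  where
  open ≡-Reasoning
  q≡l*k : q ≡ l * k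
  q≡l*k = *-cancelˡ-≡ q (l * k) a (begin
    a * q       ≡⟨ sym b≡ ⟩
    b           ≡⟨ b≡l ⟩
    l * _       ≡⟨ cong (l *_) c≡ ⟩
    l * (k * a) ≡⟨ sym (*-assoc l k a) ⟩
    l * k * a   ≡⟨ *-comm (l * k) a ⟩
    a * (l * k) ∎)
  excluded : k ≡ 1 ⊎ k ≡ q → ⊥
  excluded (inj₁ refl) = <-irrefl (sym (trans c≡ (*-identityˡ a))) a<c
  excluded (inj₂ refl) = <-irrefl (trans c≡ (trans (*-comm k a) (sym b≡))) c<b

-- Every arc of the Hasse diagram is a cover: its cofactor exceeds 1 and is not
-- composite, by factor-between.
hasse⇒cover : ∀ {n x} → 0 < n → x ∈ hasseArcs n → Cover n x
hasse⇒cover {n} {a , b} 0<n x∈ with ∈-filter⁻ (isHasseArc? n) {xs = cartesianProduct (V n) (V n)} x∈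
... | ab∈ , a<b , divides k b≡k*a , noBetween with ∈-cartesianProduct⁻ (V n) (V n) ab∈
... | a∈ , b∈ = ∈V⇒divisor a∈ , b∣n , k , k-prime , b≡a*k
  where
  b∣n = ∈V⇒divisor b∈
  instance
    a≢0 : NonZero a
    a≢0 = divisor-nonZero 0<n (∈V⇒divisor a∈)
  b≡a*k : b ≡ a * k
  b≡a*k = trans b≡k*a (*-comm k a)
  1<k : 1 < k
  1<k = *-cancelʳ-< a 1 k (subst₂ _<_ (sym (*-identityˡ a)) b≡k*a a<b)
  not-composite : ¬ Composite k
  not-composite (composite {d} d<k d∣k) = noBetween (lose (divisor∈V 0<n (∣-trans ad∣b b∣n)) between)
    where
    between = factor-between {{a≢0}} b≡a*k (nonTrivial⇒n>1 d) d<k d∣k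
    ad∣b = proj₂ (proj₂ (proj₂ between))
  k-prime : Prime k
  k-prime = prime {{n>1⇒nonTrivial 1<k}} not-composite

cover⇒hasse : ∀ {n x} → 0 < n → Cover n x → x ∈ hasseArcs n
cover⇒hasse {n} {a , b} 0<n (a∣n , b∣n , q , q-prime , b≡) =
  ∈-filter⁺ (isHasseArc? n) (∈-cartesianProduct⁺ (divisor∈V 0<n a∣n) (divisor∈V 0<n b∣n))
    (a<b , divides q (trans b≡ (*-comm a q)) , λ any → prime-factor-no-between q-prime b≡ (proj₂ (satisfied any)))
  where
  instance
    a≢0 : NonZero a
    a≢0 = divisor-nonZero 0<n a∣n
  a<b : a < b
  a<b = subst (a <_) (sym b≡) (m<m*n a q (nonTrivial⇒n>1 q {{prime⇒nonTrivial q-prime}}))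

numHasseArcs≡ : ∀ {n H} → 0 < n → Unique H → (∀ {x} → x ∈ H ⇔ Cover n x) → numHasseArcs n ≡ length H
numHasseArcs≡ {n} 0<n uH H-covers =
  unique-length (hasseArcs-unique n) uH (⇔.trans (mk⇔ (hasse⇒cover 0<n) (cover⇒hasse 0<n)) (⇔.sym H-covers))

record Enumeration (n : ℕ) (D : List ℕ) (H : List (ℕ × ℕ)) : Set where
  field
    divisors        : ∀ {d} → d ∈ D ⇔ d ∣ n
    covers          : ∀ {x} → x ∈ H ⇔ Cover n x
    divisors-unique : Unique D
    covers-unique   : Unique H

enumeration-one : Enumeration 1 [ 1 ] []
enumeration-one = record
  { divisors        = mk⇔ (λ { (here refl) → ∣-refl }) (λ d∣1 → here (∣1⇒≡1 d∣1))
  ; covers          = mk⇔ (λ ()) no-cover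
  ; divisors-unique = [] ∷ []
  ; covers-unique   = []
  }
  where
  no-cover : ∀ {x} → Cover 1 x → x ∈ []
  no-cover {a , b} (_ , b∣1 , q , q-prime , b≡) =
    ⊥-elim (nonTrivial⇒≢1 {{prime⇒nonTrivial q-prime}} (m*n≡1⇒n≡1 a q (trans (sym b≡) (∣1⇒≡1 b∣1))))

powMul : ℕ → ℕ → ℕ → ℕ
powMul p zero    r = r
powMul p (suc m) r = p * powMul p m r

powMul≡ : ∀ p m r → powMul p m r ≡ p ^ m * r
powMul≡ p zero    r = sym (+-identityʳ r)
powMul≡ p (suc m) r = trans (cong (p *_) (powMul≡ p m r)) (sym (*-assoc p (p ^ m) r))

∣-powMul : ∀ p m r → r ∣ powMul p m r
∣-powMul p zero    r = ∣-refl
∣-powMul p (suc m) r = ∣-trans (∣-powMul p m r) (n∣m*n p)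

prime-free-divisor : ∀ {p a x} → Prime p → ¬ p ∣ a → a ∣ p * x → a ∣ x
prime-free-divisor {p} {a} p-prime p∤a = coprime-divisor coprime
  where
  coprime : Coprime a p
  coprime (i∣a , i∣p) with prime⇒irreducible p-prime i∣p
  ... | inj₁ i≡1 = i≡1
  ... | inj₂ refl = ⊥-elim (p∤a i∣a)

prime-free-divisor-powMul : ∀ {p a} m r → Prime p → ¬ p ∣ a → a ∣ powMul p m r → a ∣ r
prime-free-divisor-powMul zero    r p-prime p∤a a∣ = a∣
prime-free-divisor-powMul (suc m) r p-prime p∤a a∣ =
  prime-free-divisor-powMul m r p-prime p∤a (prime-free-divisor p-prime p∤a a∣)

-- The divisors of p^m·r in layers: those of r, then p times those of p^(m-1)·r.
divisorLayers : ℕ → List ℕ → ℕ → List ℕ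
divisorLayers p D zero    = D
divisorLayers p D (suc m) = D ++ map (p *_) (divisorLayers p D m)

rise : ℕ → ℕ → ℕ × ℕ
rise p d = d , p * d

scaleArc : ℕ → ℕ × ℕ → ℕ × ℕ
scaleArc p (a , b) = p * a , p * b

-- The covers of p^m·r in layers: those of r, the rises out of the divisors of
-- r, and p times the covers of p^(m-1)·r.
coverLayers : ℕ → List ℕ → List (ℕ × ℕ) → ℕ → List (ℕ × ℕ)
coverLayers p D H zero    = H
coverLayers p D H (suc m) = H ++ (map (rise p) D ++ map (scaleArc p) (coverLayers p D H m))

divisorLayers-length : ∀ p D m → length (divisorLayers p D m) ≡ suc m * length D
divisorLayers-length p D zero    = sym (+-identityʳ (length D))
divisorLayers-length p D (suc m) = begin
  length (D ++ map (p *_) (divisorLayers p D m))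
    ≡⟨ length-++ D ⟩
  length D + length (map (p *_) (divisorLayers p D m))
    ≡⟨ cong (length D +_) (length-map (p *_) (divisorLayers p D m)) ⟩
  length D + length (divisorLayers p D m)
    ≡⟨ cong (length D +_) (divisorLayers-length p D m) ⟩
  length D + suc m * length D ∎
  where open ≡-Reasoning

coverLayers-length : ∀ p D H m → length (coverLayers p D H m) ≡ suc m * length H + m * length D
coverLayers-length p D H zero    = trans (sym (+-identityʳ (length H))) (sym (+-identityʳ _))
coverLayers-length p D H (suc m) = begin
  length (H ++ (map (rise p) D ++ map (scaleArc p) (coverLayers p D H m)))
    ≡⟨ length-++ H ⟩
  length H + length (map (rise p) D ++ map (scaleArc p) (coverLayers p D H m))
    ≡⟨ cong (length H +_) (length-++ (map (rise p) D)) ⟩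
  length H + (length (map (rise p) D) + length (map (scaleArc p) (coverLayers p D H m)))
    ≡⟨ cong (length H +_) (cong₂ _+_ (length-map (rise p) D) (length-map (scaleArc p) (coverLayers p D H m))) ⟩
  length H + (length D + length (coverLayers p D H m))
    ≡⟨ cong (λ c → length H + (length D + c)) (coverLayers-length p D H m) ⟩
  length H + (length D + (suc m * length H + m * length D))
    ≡⟨ solve 3 (λ h d m → h :+ (d :+ ((con 1 :+ m) :* h :+ m :* d))
                        := (con 1 :+ (con 1 :+ m)) :* h :+ (con 1 :+ m) :* d) refl (length H) (length D) m ⟩
  suc (suc m) * length H + suc m * length D ∎
  where open ≡-Reasoning

module Layer {p r : ℕ} (p-prime : Prime p) (p∤r : ¬ p ∣ r)
             {D : List ℕ} {H : List (ℕ × ℕ)} (enum : Enumeration r D H) where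

  open Enumeration enum

  instance
    p-nonTrivial : NonTrivial p
    p-nonTrivial = prime⇒nonTrivial p-prime
    p-nonZero : NonZero p
    p-nonZero = nonTrivial⇒nonZero p

  p∤divisor : ∀ {d} → d ∣ r → ¬ p ∣ d
  p∤divisor d∣r p∣d = p∤r (∣-trans p∣d d∣r)

  divisorLayers-sound : ∀ m {d} → d ∈ divisorLayers p D m → d ∣ powMul p m r
  divisorLayers-sound zero d∈ = to divisors d∈
  divisorLayers-sound (suc m) d∈ with ∈-++⁻ D d∈
  ... | inj₁ d∈D = ∣-trans (to divisors d∈D) (∣-powMul p (suc m) r)
  ... | inj₂ d∈pL with ∈-map⁻ (p *_) d∈pL
  ...   | e , e∈ , refl = *-monoʳ-∣ p (divisorLayers-sound m e∈)

  -- A divisor of p^(m+1)·r lies in the bottom layer if p ∤ d, and otherwise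
  -- is p times a divisor of p^m·r.
  divisorLayers-complete : ∀ m {d} → d ∣ powMul p m r → d ∈ divisorLayers p D m
  divisorLayers-complete zero d∣ = from divisors d∣
  divisorLayers-complete (suc m) {d} d∣ with p ∣? d
  ... | no p∤d = ∈-++⁺ˡ (from divisors (prime-free-divisor-powMul (suc m) r p-prime p∤d d∣))
  ... | yes (divides e refl) = ∈-++⁺ʳ D (subst (_∈ map (p *_) (divisorLayers p D m)) (*-comm p e)
          (∈-map⁺ (p *_) (divisorLayers-complete m (*-cancelˡ-∣ p (subst (_∣ p * powMul p m r) (*-comm e p) d∣)))))

  divisorLayers-unique : ∀ m → Unique (divisorLayers p D m)
  divisorLayers-unique zero    = divisors-unique
  divisorLayers-unique (suc m) =
    Unique.++⁺ divisors-unique (Unique.map⁺ (λ {x} {y} → *-cancelˡ-≡ x y p) (divisorLayers-unique m)) disjoint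
    where
    disjoint : ∀ {v} → ¬ (v ∈ D × v ∈ map (p *_) (divisorLayers p D m))
    disjoint (v∈D , v∈pL) with ∈-map⁻ (p *_) v∈pL
    ... | e , _ , refl = p∤divisor (to divisors v∈D) (m∣m*n e)

  coverLayers-sound : ∀ m {x} → x ∈ coverLayers p D H m → Cover (powMul p m r) x
  coverLayers-sound zero x∈ = to covers x∈
  coverLayers-sound (suc m) x∈ with ∈-++⁻ H x∈
  ... | inj₁ x∈H with to covers x∈H
  ...   | a∣r , b∣r , cofactor =
          ∣-trans a∣r (∣-powMul p (suc m) r) , ∣-trans b∣r (∣-powMul p (suc m) r) , cofactor
  coverLayers-sound (suc m) x∈ | inj₂ x∈′ with ∈-++⁻ (map (rise p) D) x∈′
  ... | inj₁ x∈rise with ∈-map⁻ (rise p) x∈rise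
  ...   | d , d∈D , refl = ∣-trans d∣r (∣-powMul p (suc m) r) , *-monoʳ-∣ p (∣-trans d∣r (∣-powMul p m r)) ,
                           p , p-prime , *-comm p d
    where d∣r = to divisors d∈D
  coverLayers-sound (suc m) x∈ | inj₂ x∈′ | inj₂ x∈scaled with ∈-map⁻ (scaleArc p) x∈scaled
  ... | (a , b) , ab∈ , refl with coverLayers-sound m ab∈
  ...   | a∣ , b∣ , q , q-prime , b≡ =
          *-monoʳ-∣ p a∣ , *-monoʳ-∣ p b∣ , q , q-prime , trans (cong (p *_) b≡) (sym (*-assoc p a q))

  -- A cover (a , a·q) of p^(m+1)·r is: p times a cover of p^m·r if p ∣ a; a
  -- rise if p ∤ a and q = p; a cover of r if p ∤ a and q ≠ p.
  coverLayers-complete : ∀ m {x} → Cover (powMul p m r) x → x ∈ coverLayers p D H m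
  coverLayers-complete zero cover = from covers cover
  coverLayers-complete (suc m) {a , b} (a∣ , b∣ , q , q-prime , b≡) with p ∣? a
  ... | yes (divides a′ refl) =
        ∈-++⁺ʳ H (∈-++⁺ʳ (map (rise p) D) (subst (_∈ map (scaleArc p) (coverLayers p D H m)) scaled≡
          (∈-map⁺ (scaleArc p) (coverLayers-complete m lower-cover))))
    where
    b≡p*b′ : b ≡ p * (a′ * q)
    b≡p*b′ = trans b≡ (trans (cong (_* q) (*-comm a′ p)) (*-assoc p a′ q))
    lower-cover : Cover (powMul p m r) (a′ , a′ * q)
    lower-cover = *-cancelˡ-∣ p (subst (_∣ p * powMul p m r) (*-comm a′ p) a∣)
                , *-cancelˡ-∣ p (subst (_∣ p * powMul p m r) b≡p*b′ b∣) , q , q-prime , refl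
    scaled≡ : scaleArc p (a′ , a′ * q) ≡ (a′ * p , b)
    scaled≡ = cong₂ _,_ (*-comm p a′) (sym b≡p*b′)
  ... | no p∤a with q ≟ p
  ...   | yes refl = ∈-++⁺ʳ H (∈-++⁺ˡ (subst (_∈ map (rise p) D) (cong (a ,_) (trans (*-comm q a) (sym b≡)))
                       (∈-map⁺ (rise p) (from divisors (prime-free-divisor-powMul (suc m) r p-prime p∤a a∣)))))
  ...   | no q≢p = ∈-++⁺ˡ (from covers (prime-free-divisor-powMul (suc m) r p-prime p∤a a∣ ,
                                        prime-free-divisor-powMul (suc m) r p-prime p∤b b∣ , q , q-prime , b≡))
    where
    p∤b : ¬ p ∣ b
    p∤b p∣b with euclidsLemma a q p-prime (subst (p ∣_) b≡ p∣b)
    ... | inj₁ p∣a = p∤a p∣a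
    ... | inj₂ p∣q with prime⇒irreducible q-prime p∣q
    ...   | inj₁ p≡1 = nonTrivial⇒≢1 p≡1
    ...   | inj₂ p≡q = q≢p (sym p≡q)

  -- The three parts of a layer are disjoint: the covers of r and the rises
  -- start at divisors of r, the scaled covers at multiples of p; the rises end
  -- in a multiple of p, the covers of r do not.
  coverLayers-unique : ∀ m → Unique (coverLayers p D H m)
  coverLayers-unique zero    = covers-unique
  coverLayers-unique (suc m) =
    Unique.++⁺ covers-unique (Unique.++⁺ (Unique.map⁺ rise-injective divisors-unique)
                                         (Unique.map⁺ scale-injective (coverLayers-unique m)) rise∩scaled)
               old∩new
    where
    rise-injective : ∀ {x y} → rise p x ≡ rise p y → x ≡ y
    rise-injective = cong proj₁
    scale-injective : ∀ {x y} → scaleArc p x ≡ scaleArc p y → x ≡ y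
    scale-injective {a , b} {a′ , b′} e =
      cong₂ _,_ (*-cancelˡ-≡ a a′ p (cong proj₁ e)) (*-cancelˡ-≡ b b′ p (cong proj₂ e))
    rise∩scaled : ∀ {v} → ¬ (v ∈ map (rise p) D × v ∈ map (scaleArc p) (coverLayers p D H m))
    rise∩scaled (v∈rise , v∈scaled) with ∈-map⁻ (rise p) v∈rise | ∈-map⁻ (scaleArc p) v∈scaled
    ... | d , d∈D , refl | (a , b) , _ , e = p∤divisor (to divisors d∈D) (subst (p ∣_) (sym (cong proj₁ e)) (m∣m*n a))
    top-divisible : ∀ {v} → v ∈ map (rise p) D ++ map (scaleArc p) (coverLayers p D H m) → p ∣ proj₂ v
    top-divisible v∈ with ∈-++⁻ (map (rise p) D) v∈
    ... | inj₁ v∈rise with ∈-map⁻ (rise p) v∈rise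
    ...   | d , _ , refl = m∣m*n d
    top-divisible v∈ | inj₂ v∈scaled with ∈-map⁻ (scaleArc p) v∈scaled
    ...   | (a , b) , _ , refl = m∣m*n b
    old∩new : ∀ {v} → ¬ (v ∈ H × v ∈ map (rise p) D ++ map (scaleArc p) (coverLayers p D H m))
    old∩new (v∈H , v∈new) = p∤divisor (proj₁ (proj₂ (to covers v∈H))) (top-divisible v∈new)

  layerEnumeration : ∀ m → Enumeration (powMul p m r) (divisorLayers p D m) (coverLayers p D H m)
  layerEnumeration m = record
    { divisors        = mk⇔ (divisorLayers-sound m) (divisorLayers-complete m)
    ; covers          = mk⇔ (coverLayers-sound m) (coverLayers-complete m)
    ; divisors-unique = divisorLayers-unique m
    ; covers-unique   = coverLayers-unique m
    }

Ascending : List (ℕ × ℕ) → Set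
Ascending []             = ⊤
Ascending ((p , m) ∷ fs) = Prime p × All (p <_) (map proj₁ fs) × Ascending fs

value : List (ℕ × ℕ) → ℕ
value []             = 1
value ((p , m) ∷ fs) = powMul p m (value fs)

divisorList : List (ℕ × ℕ) → List ℕ
divisorList []             = [ 1 ]
divisorList ((p , m) ∷ fs) = divisorLayers p (divisorList fs) m

coverList : List (ℕ × ℕ) → List (ℕ × ℕ)
coverList []             = []
coverList ((p , m) ∷ fs) = coverLayers p (divisorList fs) (coverList fs) m

prime∤value : ∀ {p} fs → Ascending fs → Prime p → All (p <_) (map proj₁ fs) → ¬ p ∣ value fs
prime∤value []             _ p-prime _ p∣1 = nonTrivial⇒≢1 {{prime⇒nonTrivial p-prime}} (∣1⇒≡1 p∣1)
prime∤value {p} ((q , k) ∷ fs) (q-prime , _ , asc) p-prime (p<q ∷ below) = p∤powMul k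
  where
  p∤powMul : ∀ k → ¬ p ∣ powMul q k (value fs)
  p∤powMul zero    = prime∤value fs asc p-prime below
  p∤powMul (suc k) p∣ with euclidsLemma q (powMul q k (value fs)) p-prime p∣
  ... | inj₂ p∣rest = p∤powMul k p∣rest
  ... | inj₁ p∣q with prime⇒irreducible q-prime p∣q
  ...   | inj₁ p≡1 = nonTrivial⇒≢1 {{prime⇒nonTrivial p-prime}} p≡1
  ...   | inj₂ refl = <-irrefl refl p<q

enumeration : ∀ fs → Ascending fs → Enumeration (value fs) (divisorList fs) (coverList fs)
enumeration []             _                          = enumeration-one
enumeration ((p , m) ∷ fs) (p-prime , below , asc) =
  Layer.layerEnumeration p-prime (prime∤value fs asc p-prime below) (enumeration fs asc) m

-- E computed by always removing the first element of the multiset.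
hasseCount : List ℕ → ℕ
hasseCount []      = 0
hasseCount (m ∷ M) = hasseCount M * suc m + m * VM M

divisorList-length : ∀ fs → length (divisorList fs) ≡ VM (signature fs)
divisorList-length []             = refl
divisorList-length ((p , m) ∷ fs) =
  trans (divisorLayers-length p (divisorList fs) m) (cong (suc m *_) (divisorList-length fs))

coverList-length : ∀ fs → length (coverList fs) ≡ hasseCount (signature fs)
coverList-length []             = refl
coverList-length ((p , m) ∷ fs) = begin
  length (coverLayers p D H m)
    ≡⟨ coverLayers-length p D H m ⟩
  suc m * length H + m * length D
    ≡⟨ cong₂ (λ h d → suc m * h + m * d) (coverList-length fs) (divisorList-length fs) ⟩
  suc m * hasseCount M + m * VM M
    ≡⟨ cong (_+ m * VM M) (*-comm (suc m) (hasseCount M)) ⟩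
  hasseCount M * suc m + m * VM M ∎
  where
  open ≡-Reasoning
  D = divisorList fs
  H = coverList fs
  M = signature fs

VM-↭ : ∀ {M M′} → M ↭ M′ → VM M ≡ VM M′
VM-↭ M↭M′ = product-↭ (map⁺ suc M↭M′)

hasseCount-↭ : ∀ {M M′} → M ↭ M′ → hasseCount M ≡ hasseCount M′
hasseCount-↭ _↭_.refl = refl
hasseCount-↭ (_↭_.prep x M↭M′) = cong₂ (λ e v → e * suc x + x * v) (hasseCount-↭ M↭M′) (VM-↭ M↭M′)
hasseCount-↭ (_↭_.swap {ys = M′} x y M↭M′) = trans
  (cong₂ (λ e v → (e * suc y + y * v) * suc x + x * (suc y * v)) (hasseCount-↭ M↭M′) (VM-↭ M↭M′))
  (solve 4 (λ x y e v → (e :* (con 1 :+ y) :+ y :* v) :* (con 1 :+ x) :+ x :* ((con 1 :+ y) :* v)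
                     := (e :* (con 1 :+ x) :+ x :* v) :* (con 1 :+ y) :+ y :* ((con 1 :+ x) :* v))
           refl x y (hasseCount M′) (VM M′))
hasseCount-↭ (_↭_.trans M↭M″ M″↭M′) = trans (hasseCount-↭ M↭M″) (hasseCount-↭ M″↭M′)

IsE⇒hasseCount : ∀ {M e} → IsE M e → e ≡ hasseCount M
IsE⇒hasseCount (single m) = sym (*-identityʳ m)
IsE⇒hasseCount (step m M′ e′ M↭ isE) =
  trans (cong (λ c → c * suc m + m * VM M′) (IsE⇒hasseCount isE)) (sym (hasseCount-↭ M↭))

IsE-defined : ∀ m M → ∃ λ e → IsE (m ∷ M) e
IsE-defined m []       = m , single m
IsE-defined m (m′ ∷ M) = _ , step m (m′ ∷ M) (proj₁ (IsE-defined m′ M)) ↭-refl (proj₂ (IsE-defined m′ M))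

ascending : ∀ fs → All (λ pm → Prime (proj₁ pm)) fs → Linked _<_ (map proj₁ fs) → Ascending fs
ascending []             _                   _      = tt
ascending ((p , m) ∷ fs) (p-prime ∷ primes) linked = p-prime , below linked , ascending fs primes (tail linked)
  where
  below : ∀ {p ps} → Linked _<_ (p ∷ ps) → All (p <_) ps
  below {ps = []}     _              = []
  below {ps = q ∷ qs} (p<q ∷ linked) = p<q ∷ All.map (<-trans p<q) (below linked)
  tail : ∀ {p ps} → Linked _<_ (p ∷ ps) → Linked _<_ ps
  tail [-]          = []
  tail (_ ∷ linked) = linked

product≡value : ∀ fs → product (map (λ pm → proj₁ pm ^ proj₂ pm) fs) ≡ value fs
product≡value []             = refl
product≡value ((p , m) ∷ fs) = trans (cong (p ^ m *_) (product≡value fs)) (sym (powMul≡ p m (value fs)))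

theorem2 : (n : ℕ) → 1 < n → (fs : List (ℕ × ℕ)) → IsPrimeFactorization n fs →
    (∃ λ e → IsE (signature fs) e) × (∀ e → IsE (signature fs) e → e ≡ numHasseArcs n)
theorem2 n 1<n [] (_ , _ , _ , refl) = ⊥-elim (<-irrefl refl 1<n)
theorem2 n 1<n fs@((p , m) ∷ rest) (primes , sorted , _ , product≡n) = IsE-defined m (signature rest) , counts
  where
  open Enumeration (subst (λ k → Enumeration k (divisorList fs) (coverList fs))
                          (trans (sym (product≡value fs)) product≡n) (enumeration fs (ascending fs primes sorted)))
  counts : ∀ e → IsE (signature fs) e → e ≡ numHasseArcs n
  counts e isE = begin
    e                         ≡⟨ IsE⇒hasseCount isE ⟩
    hasseCount (signature fs) ≡⟨ sym (coverList-length fs) ⟩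
    length (coverList fs)     ≡⟨ sym (numHasseArcs≡ (<-trans z<s 1<n) covers-unique covers) ⟩
    numHasseArcs n            ∎
    where open ≡-Reasoning
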